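{- Let $D$ be a strict and asymmetric digraph without isolated vertices, and let $D'$ be the digraph obtained from $D$ by the splitting procedure described in the context. Then $L(D)$ is connected if and only if $D'$ is weakly connected.
   Context: A digraph is strict if it has no loops and no parallel arcs; it is asymmetric if whenever $(u,v)$ is an arc, $(v,u)$ is not an arc. A digraph is weakly connected if its underlying undirected graph is connected. The line graph $L(D)$ of a digraph $D$ is the graph whose vertex set is the arc set of $D$, in which two arcs are adjacent if and only if they form a directed path of length $2$ (arcs $(u,v),(v,w)$ with $u,v,w$ distinct). The digraph $D'$ is obtained from $D$ by repeatedly applying the following operations until neither applies: if some vertex $v$ has out-degree $0$ and in-degree $k\geq 2$, replace $v$ by $k$ new vertices $v_1,\dots,v_k$ so that each of the $k$ arcs with head $v$ becomes an arc with head a distinct $v_i$ (tails unchanged); if some vertex $u$ has in-degree $0$ and out-degree $l\geq 2$, replace $u$ by $l$ new vertices $u_1,\dots,u_l$ so that each of the $l$ arcs with tail $u$ becomes an arc with tail a distinct $u_j$ (heads unchanged). -}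

module Defs where

open import Data.Fin using (Fin)
open import Data.Fin.Properties using () renaming (_≟_ to _≟ᶠ_)
open import Data.Nat using (ℕ)
open import Data.Product using (Σ; ∃; _×_; _,_)
open import Data.Sum using (_⊎_; inj₁; inj₂)
open import Data.Sum.Properties using (≡-dec)
open import Relation.Nullary using (¬_; yes; no)
open import Relation.Nullary.Decidable using (map′)
open import Relation.Binary.Definitions using (DecidableEquality)
open import Relation.Binary.PropositionalEquality using (_≡_; _≢_; refl; cong)
open import Relation.Binary.Construct.Closure.ReflexiveTransitive using (Star)
open import Level using (0ℓ)

record Digraph : Set₁ where
  field
    V     : Set
    A     : Set
    _≟V_  : DecidableEquality V
    _≟A_  : DecidableEquality A
    tail  : A → V
    head  : A → V
open Digraph public

mkDigraph : (n m : ℕ) → (Fin m → Fin n) → (Fin m → Fin n) → Digraph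
mkDigraph n m t h = record
  { V = Fin n ; A = Fin m ; _≟V_ = _≟ᶠ_ ; _≟A_ = _≟ᶠ_ ; tail = t ; head = h }

Strict : Digraph → Set
Strict D = (∀ a → tail D a ≢ head D a)
         × (∀ a b → tail D a ≡ tail D b → head D a ≡ head D b → a ≡ b)

Asymmetric : Digraph → Set
Asymmetric D = ∀ a b → ¬ (tail D a ≡ head D b × head D a ≡ tail D b)

NoIsolated : Digraph → Set
NoIsolated D = ∀ v → ∃ λ a → (tail D a ≡ v) ⊎ (head D a ≡ v)

UAdj : (D : Digraph) → V D → V D → Set
UAdj D u w = ∃ λ a → (tail D a ≡ u × head D a ≡ w) ⊎ (tail D a ≡ w × head D a ≡ u)

WeaklyConnected : Digraph → Set
WeaklyConnected D = ∀ u w → Star (UAdj D) u w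

-- the line graph L(D): arcs a, b adjacent iff they form a directed path
-- of length 2 (in either order) through three distinct vertices
DiPath2 : (D : Digraph) → A D → A D → Set
DiPath2 D a b = head D a ≡ tail D b
              × tail D a ≢ head D a × head D a ≢ head D b × tail D a ≢ head D b

LAdj : (D : Digraph) → A D → A D → Set
LAdj D a b = DiPath2 D a b ⊎ DiPath2 D b a

LConnected : Digraph → Set
LConnected D = ∀ a b → Star (LAdj D) a b

-- Degree conditions (no counting needed: "in-degree k ≥ 2" means
-- at least two distinct arcs have head v)

OutDeg0 : (D : Digraph) → V D → Set
OutDeg0 D v = ∀ a → tail D a ≢ v

InDeg0 : (D : Digraph) → V D → Set
InDeg0 D v = ∀ a → head D a ≢ v

InDeg≥2 : (D : Digraph) → V D → Set
InDeg≥2 D v = Σ (A D) λ a → Σ (A D) λ b → a ≢ b × head D a ≡ v × head D b ≡ v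

OutDeg≥2 : (D : Digraph) → V D → Set
OutDeg≥2 D v = Σ (A D) λ a → Σ (A D) λ b → a ≢ b × tail D a ≡ v × tail D b ≡ v

record Other (X : Set) (v : X) : Set where
  constructor other
  field
    val  : X
    .ne  : val ≢ v
open Other public

record ArcAt (X : Set) (Y : Set) (f : Y → X) (v : X) : Set where
  constructor arcAt
  field
    arc  : Y
    .at  : f arc ≡ v
open ArcAt public

Other-dec : {X : Set} {v : X} → DecidableEquality X → DecidableEquality (Other X v)
Other-dec d (other x _) (other y _) = map′ (λ { refl → refl }) (cong val) (d x y)

ArcAt-dec : {X Y : Set} {f : Y → X} {v : X} → DecidableEquality Y → DecidableEquality (ArcAt X Y f v)
ArcAt-dec d (arcAt x _) (arcAt y _) = map′ (λ { refl → refl }) (cong arc) (d x y)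

-- Replace a sink v (out-degree 0) by one new vertex per arc with head v.
splitSink : (D : Digraph) (v : V D) → OutDeg0 D v → Digraph
splitSink D v out0 = record
  { V = Other (V D) v ⊎ ArcAt (V D) (A D) (head D) v
  ; A = A D
  ; _≟V_ = ≡-dec (Other-dec (_≟V_ D)) (ArcAt-dec (_≟A_ D))
  ; _≟A_ = _≟A_ D
  ; tail = λ a → inj₁ (other (tail D a) (out0 a))
  ; head = hd
  }
  where
  hd : A D → Other (V D) v ⊎ ArcAt (V D) (A D) (head D) v
  hd a with _≟V_ D (head D a) v
  ... | yes p = inj₂ (arcAt a p)
  ... | no ¬p = inj₁ (other (head D a) ¬p)

-- Replace a source u (in-degree 0) by one new vertex per arc with tail u.
splitSource : (D : Digraph) (u : V D) → InDeg0 D u → Digraph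
splitSource D u in0 = record
  { V = Other (V D) u ⊎ ArcAt (V D) (A D) (tail D) u
  ; A = A D
  ; _≟V_ = ≡-dec (Other-dec (_≟V_ D)) (ArcAt-dec (_≟A_ D))
  ; _≟A_ = _≟A_ D
  ; tail = tl
  ; head = λ a → inj₁ (other (head D a) (in0 a))
  }
  where
  tl : A D → Other (V D) u ⊎ ArcAt (V D) (A D) (tail D) u
  tl a with _≟V_ D (tail D a) u
  ... | yes p = inj₂ (arcAt a p)
  ... | no ¬p = inj₁ (other (tail D a) ¬p)

data SplitStep : Digraph → Digraph → Set₁ where
  sink   : (D : Digraph) (v : V D) (o : OutDeg0 D v) → InDeg≥2 D v →
           SplitStep D (splitSink D v o)
  source : (D : Digraph) (u : V D) (i : InDeg0 D u) → OutDeg≥2 D u →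
           SplitStep D (splitSource D u i)

SplitTerminal : Digraph → Set
SplitTerminal D = ∀ v → ¬ ((OutDeg0 D v × InDeg≥2 D v) ⊎ (InDeg0 D v × OutDeg≥2 D v))

ObtainedBySplitting : Digraph → Digraph → Set₁
ObtainedBySplitting D D' = Star SplitStep D D' × SplitTerminal D'

-- Splitting a sink or a source changes neither which arcs are consecutive
-- (a sink is the tail of no arc, a source the head of none) nor the
-- looplessness, asymmetry and absence of isolated vertices of the digraph,
-- so L(D) and L(D') have the same adjacency and connectivity.  In the
-- terminal digraph D' two arcs at a common vertex are joined in L(D'): if
-- both enter x, then x is not a split sink, so some arc leaves x and follows
-- both of them (dually if both leave x).  Hence a walk in the underlying
-- graph of D' lifts to a walk in L(D'), and conversely every walk in L(D')
-- projects to a walk through the tails of its arcs.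
module Submission where

open import Defs
open import Data.Nat using (ℕ)
open import Data.Fin using (Fin)
open import Data.Fin.Properties using (any?)
open import Data.Product using (∃; _,_; proj₁)
open import Data.Sum using (_⊎_; inj₁; inj₂)
open import Data.Empty using (⊥-elim)
import Data.Empty.Irrelevant as Irrelevant
open import Function using (id; _∘_)
open import Function.Bundles using (_⇔_; mk⇔)
open import Function.Construct.Composition using (_⇔-∘_)
open import Function.Construct.Identity using (⇔-id)
open import Level using (0ℓ)
open import Relation.Nullary using (Dec; yes; no)
open import Relation.Unary using (Pred; Decidable)
open import Relation.Binary using (Rel)
open import Relation.Binary.PropositionalEquality
  using (_≡_; _≢_; refl; sym; trans; cong)
open import Relation.Binary.Construct.Closure.ReflexiveTransitive
  using (Star; ε; _◅_; _◅◅_; map; fold)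

Connected : ∀ {ℓ} {X : Set} → Rel X ℓ → Set ℓ
Connected R = ∀ x y → Star R x y

connected-⇔ : ∀ {ℓ} {X : Set} {R S : Rel X ℓ} →
              (∀ {x y} → R x y → S x y) → (∀ {x y} → S x y → R x y) →
              Connected R ⇔ Connected S
connected-⇔ R⇒S S⇒R = mk⇔ (λ c x y → map R⇒S (c x y)) (λ c x y → map S⇒R (c x y))

Loopless : Digraph → Set
Loopless D = ∀ a → tail D a ≢ head D a

Consecutive : (D : Digraph) → Rel (A D) _
Consecutive D a b = head D a ≡ tail D b ⊎ head D b ≡ tail D a

ArcConnected : Digraph → Set
ArcConnected D = Connected (Consecutive D)

module _ {D : Digraph} (loopless : Loopless D) (asymmetric : Asymmetric D) where

  diPath2 : ∀ {a b} → head D a ≡ tail D b → DiPath2 D a b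
  diPath2 {a} {b} ha≡tb =
    ha≡tb , loopless a , (λ ha≡hb → loopless b (trans (sym ha≡tb) ha≡hb))
          , (λ ta≡hb → asymmetric a b (ta≡hb , ha≡tb))

  consecutive⇒LAdj : ∀ {a b} → Consecutive D a b → LAdj D a b
  consecutive⇒LAdj (inj₁ ha≡tb) = inj₁ (diPath2 ha≡tb)
  consecutive⇒LAdj (inj₂ hb≡ta) = inj₂ (diPath2 hb≡ta)

  LConnected⇔ArcConnected : LConnected D ⇔ ArcConnected D
  LConnected⇔ArcConnected = connected-⇔ LAdj⇒consecutive consecutive⇒LAdj
    where
    LAdj⇒consecutive : ∀ {a b} → LAdj D a b → Consecutive D a b
    LAdj⇒consecutive (inj₁ p) = inj₁ (proj₁ p)
    LAdj⇒consecutive (inj₂ p) = inj₂ (proj₁ p)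

record Homomorphism (E D : Digraph) : Set where
  field
    vertexMap    : V E → V D
    arcMap       : A E → A D
    tail-commute : ∀ a → tail D (arcMap a) ≡ vertexMap (tail E a)
    head-commute : ∀ a → head D (arcMap a) ≡ vertexMap (head E a)

module _ {E D : Digraph} (φ : Homomorphism E D) where
  open Homomorphism φ

  loopless-reflect : Loopless D → Loopless E
  loopless-reflect loopless a ta≡ha =
    loopless (arcMap a) (trans (tail-commute a) (trans (cong vertexMap ta≡ha) (sym (head-commute a))))

  asymmetric-reflect : Asymmetric D → Asymmetric E
  asymmetric-reflect asymmetric a b (ta≡hb , ha≡tb) = asymmetric (arcMap a) (arcMap b)
    ( trans (tail-commute a) (trans (cong vertexMap ta≡hb) (sym (head-commute b)))
    , trans (head-commute a) (trans (cong vertexMap ha≡tb) (sym (tail-commute b))))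

  consecutive-preserve : ∀ {a b} → Consecutive E a b → Consecutive D (arcMap a) (arcMap b)
  consecutive-preserve {a} {b} (inj₁ ha≡tb) =
    inj₁ (trans (head-commute a) (trans (cong vertexMap ha≡tb) (sym (tail-commute b))))
  consecutive-preserve {a} {b} (inj₂ hb≡ta) =
    inj₂ (trans (head-commute b) (trans (cong vertexMap hb≡ta) (sym (tail-commute a))))

SearchableArcs : Digraph → Set₁
SearchableArcs D = ∀ {P : Pred (A D) 0ℓ} → Decidable P → Dec (∃ P)

record Admissible (D : Digraph) : Set₁ where
  field
    loopless   : Loopless D
    asymmetric : Asymmetric D
    noIsolated : NoIsolated D
    search     : SearchableArcs D

unsplit : ∀ {X Y : Set} {f : Y → X} {v : X} → Other X v ⊎ ArcAt X Y f v → X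
unsplit (inj₁ x) = val x
unsplit {v = v} (inj₂ _) = v

other-cong : ∀ {X : Set} {v x y : X} .{x≢v : x ≢ v} .{y≢v : y ≢ v} →
             x ≡ y → other {X} {v} x x≢v ≡ other y y≢v
other-cong refl = refl

module SplitSink (D : Digraph) (v : V D) (out0 : OutDeg0 D v) where
  D₁ : Digraph
  D₁ = splitSink D v out0

  head-cases : ∀ a → (∃ λ (ha≡v : head D a ≡ v) → head D₁ a ≡ inj₂ (arcAt a ha≡v))
                   ⊎ (∃ λ (ha≢v : head D a ≢ v) → head D₁ a ≡ inj₁ (other (head D a) ha≢v))
  head-cases a with _≟V_ D (head D a) v
  ... | yes ha≡v = inj₁ (ha≡v , refl)
  ... | no ha≢v  = inj₂ (ha≢v , refl)

  unsplitHom : Homomorphism D₁ D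
  unsplitHom = record
    { vertexMap = unsplit ; arcMap = id ; tail-commute = λ _ → refl ; head-commute = head-commute }
    where
    head-commute : ∀ a → head D a ≡ unsplit (head D₁ a)
    head-commute a with head-cases a
    ... | inj₁ (ha≡v , eq) = trans ha≡v (cong unsplit (sym eq))
    ... | inj₂ (_ , eq)    = cong unsplit (sym eq)

  -- An arc followed by b does not end in the sink v, so its head is untouched.
  consecutive-split : ∀ a b → head D a ≡ tail D b → head D₁ a ≡ tail D₁ b
  consecutive-split a b ha≡tb with head-cases a
  ... | inj₁ (ha≡v , _) = ⊥-elim (out0 b (trans (sym ha≡tb) ha≡v))
  ... | inj₂ (_ , eq)   = trans eq (cong inj₁ (other-cong ha≡tb))

  arcConnected-⇔ : ArcConnected D ⇔ ArcConnected D₁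
  arcConnected-⇔ = connected-⇔ split (consecutive-preserve unsplitHom)
    where
    split : ∀ {a b} → Consecutive D a b → Consecutive D₁ a b
    split {a} {b} (inj₁ ha≡tb) = inj₁ (consecutive-split a b ha≡tb)
    split {a} {b} (inj₂ hb≡ta) = inj₂ (consecutive-split b a hb≡ta)

  noIsolated : NoIsolated D → NoIsolated D₁
  noIsolated noIso (inj₁ (other x x≢v)) with noIso x
  ... | a , inj₁ ta≡x = a , inj₁ (cong inj₁ (other-cong ta≡x))
  ... | a , inj₂ ha≡x with head-cases a
  ...   | inj₁ (ha≡v , _) = Irrelevant.⊥-elim (x≢v (trans (sym ha≡x) ha≡v))
  ...   | inj₂ (_ , eq)   = a , inj₂ (trans eq (cong inj₁ (other-cong ha≡x)))
  noIsolated noIso (inj₂ (arcAt a ha≡v)) with head-cases a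
  ... | inj₁ (_ , eq)    = a , inj₂ eq
  ... | inj₂ (ha≢v , _) = Irrelevant.⊥-elim (ha≢v ha≡v)

  admissible : Admissible D → Admissible D₁
  admissible adm = record
    { loopless   = loopless-reflect unsplitHom (Admissible.loopless adm)
    ; asymmetric = asymmetric-reflect unsplitHom (Admissible.asymmetric adm)
    ; noIsolated = noIsolated (Admissible.noIsolated adm)
    ; search     = Admissible.search adm
    }

module SplitSource (D : Digraph) (u : V D) (in0 : InDeg0 D u) where
  D₁ : Digraph
  D₁ = splitSource D u in0

  tail-cases : ∀ a → (∃ λ (ta≡u : tail D a ≡ u) → tail D₁ a ≡ inj₂ (arcAt a ta≡u))
                   ⊎ (∃ λ (ta≢u : tail D a ≢ u) → tail D₁ a ≡ inj₁ (other (tail D a) ta≢u))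
  tail-cases a with _≟V_ D (tail D a) u
  ... | yes ta≡u = inj₁ (ta≡u , refl)
  ... | no ta≢u  = inj₂ (ta≢u , refl)

  unsplitHom : Homomorphism D₁ D
  unsplitHom = record
    { vertexMap = unsplit ; arcMap = id ; tail-commute = tail-commute ; head-commute = λ _ → refl }
    where
    tail-commute : ∀ a → tail D a ≡ unsplit (tail D₁ a)
    tail-commute a with tail-cases a
    ... | inj₁ (ta≡u , eq) = trans ta≡u (cong unsplit (sym eq))
    ... | inj₂ (_ , eq)    = cong unsplit (sym eq)

  -- An arc following a does not start at the source u, so its tail is untouched.
  consecutive-split : ∀ a b → head D a ≡ tail D b → head D₁ a ≡ tail D₁ b
  consecutive-split a b ha≡tb with tail-cases b
  ... | inj₁ (tb≡u , _) = ⊥-elim (in0 a (trans ha≡tb tb≡u))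
  ... | inj₂ (_ , eq)   = trans (cong inj₁ (other-cong ha≡tb)) (sym eq)

  arcConnected-⇔ : ArcConnected D ⇔ ArcConnected D₁
  arcConnected-⇔ = connected-⇔ split (consecutive-preserve unsplitHom)
    where
    split : ∀ {a b} → Consecutive D a b → Consecutive D₁ a b
    split {a} {b} (inj₁ ha≡tb) = inj₁ (consecutive-split a b ha≡tb)
    split {a} {b} (inj₂ hb≡ta) = inj₂ (consecutive-split b a hb≡ta)

  noIsolated : NoIsolated D → NoIsolated D₁
  noIsolated noIso (inj₁ (other x x≢u)) with noIso x
  ... | a , inj₂ ha≡x = a , inj₂ (cong inj₁ (other-cong ha≡x))
  ... | a , inj₁ ta≡x with tail-cases a
  ...   | inj₁ (ta≡u , _) = Irrelevant.⊥-elim (x≢u (trans (sym ta≡x) ta≡u))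
  ...   | inj₂ (_ , eq)   = a , inj₁ (trans eq (cong inj₁ (other-cong ta≡x)))
  noIsolated noIso (inj₂ (arcAt a ta≡u)) with tail-cases a
  ... | inj₁ (_ , eq)    = a , inj₁ eq
  ... | inj₂ (ta≢u , _) = Irrelevant.⊥-elim (ta≢u ta≡u)

  admissible : Admissible D → Admissible D₁
  admissible adm = record
    { loopless   = loopless-reflect unsplitHom (Admissible.loopless adm)
    ; asymmetric = asymmetric-reflect unsplitHom (Admissible.asymmetric adm)
    ; noIsolated = noIsolated (Admissible.noIsolated adm)
    ; search     = Admissible.search adm
    }

splitStep-admissible : ∀ {D E} → SplitStep D E → Admissible D → Admissible E
splitStep-admissible (sink D v out0 _)  = SplitSink.admissible D v out0
splitStep-admissible (source D u in0 _) = SplitSource.admissible D u in0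

splitStep-arcConnected : ∀ {D E} → SplitStep D E → ArcConnected D ⇔ ArcConnected E
splitStep-arcConnected (sink D v out0 _)  = SplitSink.arcConnected-⇔ D v out0
splitStep-arcConnected (source D u in0 _) = SplitSource.arcConnected-⇔ D u in0

splitting-admissible : ∀ {D E} → Star SplitStep D E → Admissible D → Admissible E
splitting-admissible = fold (λ D E → Admissible D → Admissible E)
                            (λ step rest → rest ∘ splitStep-admissible step) id

splitting-arcConnected : ∀ {D E} → Star SplitStep D E → ArcConnected D ⇔ ArcConnected E
splitting-arcConnected = fold (λ D E → ArcConnected D ⇔ ArcConnected E)
                              (λ step rest → rest ⇔-∘ splitStep-arcConnected step) (⇔-id _)

module Terminal {D : Digraph} (terminal : SplitTerminal D) (adm : Admissible D) where
  open Admissible adm using (noIsolated; search)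

  Incident : A D → V D → Set
  Incident a x = tail D a ≡ x ⊎ head D a ≡ x

  common-head-connected : ∀ {x} c d → head D c ≡ x → head D d ≡ x → Star (Consecutive D) c d
  common-head-connected {x} c d hc≡x hd≡x with _≟A_ D c d
  ... | yes refl = ε
  ... | no c≢d with search (λ e → _≟V_ D (tail D e) x)
  ...   | yes (e , te≡x) = inj₁ (trans hc≡x (sym te≡x)) ◅ inj₂ (trans hd≡x (sym te≡x)) ◅ ε
  ...   | no noOut = ⊥-elim (terminal x (inj₁ ((λ e te≡x → noOut (e , te≡x)) , c , d , c≢d , hc≡x , hd≡x)))

  common-tail-connected : ∀ {x} c d → tail D c ≡ x → tail D d ≡ x → Star (Consecutive D) c d
  common-tail-connected {x} c d tc≡x td≡x with _≟A_ D c d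
  ... | yes refl = ε
  ... | no c≢d with search (λ e → _≟V_ D (head D e) x)
  ...   | yes (e , he≡x) = inj₂ (trans he≡x (sym tc≡x)) ◅ inj₁ (trans he≡x (sym td≡x)) ◅ ε
  ...   | no noIn = ⊥-elim (terminal x (inj₂ ((λ e he≡x → noIn (e , he≡x)) , c , d , c≢d , tc≡x , td≡x)))

  incident-connected : ∀ {x} c d → Incident c x → Incident d x → Star (Consecutive D) c d
  incident-connected c d (inj₁ tc≡x) (inj₁ td≡x) = common-tail-connected c d tc≡x td≡x
  incident-connected c d (inj₂ hc≡x) (inj₂ hd≡x) = common-head-connected c d hc≡x hd≡x
  incident-connected c d (inj₂ hc≡x) (inj₁ td≡x) = inj₁ (trans hc≡x (sym td≡x)) ◅ ε
  incident-connected c d (inj₁ tc≡x) (inj₂ hd≡x) = inj₂ (trans hd≡x (sym tc≡x)) ◅ ε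

  walk⇒arcWalk : ∀ {x y} → Star (UAdj D) x y →
                 ∀ c d → Incident c x → Incident d y → Star (Consecutive D) c d
  walk⇒arcWalk ε c d cx dy = incident-connected c d cx dy
  walk⇒arcWalk ((e , inj₁ (te≡x , he≡z)) ◅ walk) c d cx dy =
    incident-connected c e cx (inj₁ te≡x) ◅◅ walk⇒arcWalk walk e d (inj₂ he≡z) dy
  walk⇒arcWalk ((e , inj₂ (te≡z , he≡x)) ◅ walk) c d cx dy =
    incident-connected c e cx (inj₂ he≡x) ◅◅ walk⇒arcWalk walk e d (inj₁ te≡z) dy

  arcWalk⇒tailWalk : ∀ {c d} → Star (Consecutive D) c d → Star (UAdj D) (tail D c) (tail D d)
  arcWalk⇒tailWalk ε = ε
  arcWalk⇒tailWalk {c} (inj₁ hc≡te ◅ walk) = (c , inj₁ (refl , hc≡te)) ◅ arcWalk⇒tailWalk walk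
  arcWalk⇒tailWalk (_◅_ {j = e} (inj₂ he≡tc) walk) = (e , inj₂ (refl , he≡tc)) ◅ arcWalk⇒tailWalk walk

  to-tail : ∀ {x} c → Incident c x → Star (UAdj D) x (tail D c)
  to-tail c (inj₁ refl) = ε
  to-tail c (inj₂ hc≡x) = (c , inj₂ (refl , hc≡x)) ◅ ε

  from-tail : ∀ {x} c → Incident c x → Star (UAdj D) (tail D c) x
  from-tail c (inj₁ refl) = ε
  from-tail c (inj₂ hc≡x) = (c , inj₁ (refl , hc≡x)) ◅ ε

  arcConnected⇔weaklyConnected : ArcConnected D ⇔ WeaklyConnected D
  arcConnected⇔weaklyConnected = mk⇔ weakly arcs
    where
    weakly : ArcConnected D → WeaklyConnected D
    weakly conn x y with noIsolated x | noIsolated y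
    ... | c , cx | d , dy = to-tail c cx ◅◅ arcWalk⇒tailWalk (conn c d) ◅◅ from-tail d dy
    arcs : WeaklyConnected D → ArcConnected D
    arcs conn c d = walk⇒arcWalk (conn (tail D c) (tail D d)) c d (inj₁ refl) (inj₁ refl)

theorem2p1 : (n m : ℕ) (t h : Fin m → Fin n) →
    Strict (mkDigraph n m t h) →
    Asymmetric (mkDigraph n m t h) →
    NoIsolated (mkDigraph n m t h) →
    (D' : Digraph) → ObtainedBySplitting (mkDigraph n m t h) D' →
    LConnected (mkDigraph n m t h) ⇔ WeaklyConnected D'
theorem2p1 n m t h (loopless , _) asymmetric noIsolated D' (steps , terminal) =
  Terminal.arcConnected⇔weaklyConnected terminal (splitting-admissible steps admissible)
    ⇔-∘ (splitting-arcConnected steps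
    ⇔-∘ LConnected⇔ArcConnected {mkDigraph n m t h} loopless asymmetric)
  where
  admissible : Admissible (mkDigraph n m t h)
  admissible = record
    { loopless = loopless ; asymmetric = asymmetric ; noIsolated = noIsolated ; search = any? }
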